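{- Let $s\leq n$ be natural numbers and let $\mathcal{F}\subseteq\binom{[n]}{s}$ have the unique face property. Then $\mathcal{F}$ has VC-dimension less than $s$.
   Context: $[n]=\{1,\dots,n\}$ and $\binom{[n]}{s}$ is the set of $s$-element subsets of $[n]$. A set $A$ is shattered by a family $\mathcal{F}$ if $\{A\cap S: S\in\mathcal{F}\}=2^A$; the VC-dimension of $\mathcal{F}$ is the size of the largest finite set shattered by $\mathcal{F}$. A family $\mathcal{F}\subseteq\binom{[n]}{s}$ has the unique face property if for every $S\in\mathcal{F}$ there is a proper subset $K\subsetneq S$ such that $S$ is the only member of $\mathcal{F}$ containing $K$. -}

module Defs where

open import Level using (0ℓ)
open import Data.Nat using (ℕ; _<_)
open import Data.Fin.Subset using (Subset; _⊆_; _⊂_; _∩_; ∣_∣)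
open import Data.Product using (Σ; ∃; _×_)
open import Relation.Unary using (Pred; _∈_)
open import Relation.Binary.PropositionalEquality using (_≡_)

Family : ℕ → Set₁
Family n = Pred (Subset n) 0ℓ

Uniform : ∀ {n} → ℕ → Family n → Set
Uniform s F = ∀ S → S ∈ F → ∣ S ∣ ≡ s

Shattered : ∀ {n} → Family n → Subset n → Set
Shattered F A = ∀ B → B ⊆ A → ∃ λ S → S ∈ F × A ∩ S ≡ B

VCdim< : ∀ {n} → Family n → ℕ → Set
VCdim< F d = ∀ A → Shattered F A → ∣ A ∣ < d

UniqueFace : ∀ {n} → Family n → Set
UniqueFace F = ∀ S → S ∈ F →
  ∃ λ K → K ⊂ S × (∀ T → T ∈ F → K ⊆ T → T ≡ S)

{-# OPTIONS --safe #-}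
module Submission where

-- A shattered set A with s ≤ |A| is the trace A ∩ S of a member S ⊇ A, and |S| = s forces A = S,
-- so A ∈ F. Take a unique face K ⊂ A and x ∈ A ∖ K: the member T with A ∩ T = A - x contains K,
-- hence T = A and A - x = A ∩ A = A, which is absurd since x ∈ A.

open import Defs
open import Data.Nat using (ℕ; _≤_; _<?_; s≤s)
open import Data.Nat.Properties using (≤-pred; ≮⇒≥; <⇒≱)
open import Data.Vec using (_∷_; []; here)
open import Data.Fin.Subset using (Subset; _⊆_; _∩_; _-_; ∣_∣; inside; outside)
open import Data.Fin.Subset.Properties
  using (drop-∷-⊆; p⊆q⇒∣p∣≤∣q∣; p∩q⊆q; ∩-idem; p─q⊆p; x∈p∧x≢y⇒x∈p-y; x∈p⇒p-x⊂p; ⊂-irref)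
open import Data.Product using (_,_)
open import Data.Empty using (⊥-elim)
open import Relation.Unary using (_∈_; _∉_)
open import Relation.Nullary.Decidable using (decidable-stable)
open import Relation.Binary.PropositionalEquality using (_≡_; refl; cong; subst; sym; trans)

p⊆q∧∣q∣≤∣p∣⇒p≡q : ∀ {n} {p q : Subset n} → p ⊆ q → ∣ q ∣ ≤ ∣ p ∣ → p ≡ q
p⊆q∧∣q∣≤∣p∣⇒p≡q {p = []}          {[]}          _   _ = refl
p⊆q∧∣q∣≤∣p∣⇒p≡q {p = outside ∷ p} {outside ∷ q} p⊆q c =
  cong (outside ∷_) (p⊆q∧∣q∣≤∣p∣⇒p≡q (drop-∷-⊆ p⊆q) c)
p⊆q∧∣q∣≤∣p∣⇒p≡q {p = outside ∷ p} {inside ∷ q}  p⊆q c =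
  ⊥-elim (<⇒≱ (s≤s (p⊆q⇒∣p∣≤∣q∣ (drop-∷-⊆ p⊆q))) c)
p⊆q∧∣q∣≤∣p∣⇒p≡q {p = inside ∷ p}  {outside ∷ q} p⊆q c with () ← p⊆q here
p⊆q∧∣q∣≤∣p∣⇒p≡q {p = inside ∷ p}  {inside ∷ q}  p⊆q c =
  cong (inside ∷_) (p⊆q∧∣q∣≤∣p∣⇒p≡q (drop-∷-⊆ p⊆q) (≤-pred c))

trace⊆ : ∀ {n} {A S B : Subset n} → A ∩ S ≡ B → B ⊆ S
trace⊆ {A = A} {S} A∩S≡B = subst (_⊆ S) A∩S≡B (p∩q⊆q A S)

module _ {n : ℕ} {F : Family n} where

  uniform∧shattered⇒large∈ : ∀ {s A} → Uniform s F → Shattered F A → s ≤ ∣ A ∣ → A ∈ F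
  uniform∧shattered⇒large∈ {A = A} uniform shattered s≤∣A∣
    with S , S∈F , A∩S≡A ← shattered A (λ x∈A → x∈A) =
    subst (_∈ F) (sym A≡S) S∈F
    where
      A≡S : A ≡ S
      A≡S = p⊆q∧∣q∣≤∣p∣⇒p≡q (trace⊆ A∩S≡A) (subst (_≤ ∣ A ∣) (sym (uniform S S∈F)) s≤∣A∣)

  uniqueFace∧shattered⇒∉ : ∀ {A} → UniqueFace F → Shattered F A → A ∉ F
  uniqueFace∧shattered⇒∉ {A} uniqueFace shattered A∈F
    with K , (K⊆A , x , x∈A , x∉K) , unique ← uniqueFace A A∈F
    with T , T∈F , A∩T≡A-x ← shattered (A - x) (p─q⊆p A _) =
    ⊂-irref A-x≡A (x∈p⇒p-x⊂p x∈A)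
    where
      K⊆A-x : K ⊆ A - x
      K⊆A-x y∈K = x∈p∧x≢y⇒x∈p-y (K⊆A y∈K) (λ { refl → x∉K y∈K })

      T≡A : T ≡ A
      T≡A = unique T T∈F (λ y∈K → trace⊆ A∩T≡A-x (K⊆A-x y∈K))

      A-x≡A : A - x ≡ A
      A-x≡A = trans (sym A∩T≡A-x) (trans (cong (A ∩_) T≡A) (∩-idem A))

mainTheorem7 : (n s : ℕ) → s ≤ n → (F : Family n) →
    Uniform s F → UniqueFace F → VCdim< F s
mainTheorem7 n s _ F uniform uniqueFace A shattered =
  decidable-stable (∣ A ∣ <? s) λ ∣A∣≮s →
    uniqueFace∧shattered⇒∉ uniqueFace shattered
      (uniform∧shattered⇒large∈ uniform shattered (≮⇒≥ ∣A∣≮s))
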